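{- Let $K$ be an algebraically closed field of characteristic zero and $E/K$ an elliptic curve given by a Weierstrass equation $y^2+a_1xy+a_3y=x^3+a_2x^2+a_4x+a_6$, with usual $b$-invariants $b_2,b_4,b_6,b_8$. Let $\delta_1(x_1,x_2)=x_1^4-b_4x_1^2x_2^2-2b_6x_1x_2^3-b_8x_2^4$ and $\delta_2(x_1,x_2)=4x_1^3x_2+b_2x_1^2x_2^2+2b_4x_1x_2^3+b_6x_2^4$. Then there are quadratic forms $y_1,y_2,y_3\in K[x_1,x_2]$ and constants $a_{ij},b_{jk}\in K$, depending only on $E$, such that for $i=1,2$ and $j=1,2,3$, \[ x_i^2=\sum_{j=1}^3 a_{ij}\,y_j(x_1,x_2)\quad\text{and}\quad y_j(x_1,x_2)^2=\sum_{k=1}^2 b_{jk}\,\delta_k(x_1,x_2) \] in $K[x_1,x_2]$. -}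

module Defs where

open import Level using (Level)
open import Data.Nat using (ℕ; zero; suc)
open import Data.Fin using (Fin; zero; suc)
open import Data.Vec using (Vec; []; _∷_)
open import Data.Product using (Σ; ∃; _×_; _,_)
open import Relation.Binary.PropositionalEquality using (_≡_)
open import Relation.Nullary using (¬_)
open import Algebra.Bundles using (CommutativeRing)

module _ {c ℓ : Level} (R : CommutativeRing c ℓ) where
  open CommutativeRing R hiding (zero)

  IsField : Set (c Level.⊔ ℓ)
  IsField = (¬ (1# ≈ 0#)) × (∀ x → ¬ (x ≈ 0#) → ∃ λ y → x * y ≈ 1#)

  fromℕ : ℕ → Carrier
  fromℕ zero = 0#
  fromℕ (suc n) = 1# + fromℕ n

  CharZero : Set ℓ
  CharZero = ∀ n → fromℕ n ≈ 0# → n ≡ 0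

  pow : Carrier → ℕ → Carrier
  pow x zero = 1#
  pow x (suc n) = x * pow x n

  evalCoeffs : ∀ {n} → Vec Carrier n → Carrier → Carrier
  evalCoeffs [] x = 0#
  evalCoeffs (a ∷ as) x = a + x * evalCoeffs as x

  AlgClosed : Set (c Level.⊔ ℓ)
  AlgClosed = ∀ n (cs : Vec Carrier (suc n)) →
              ∃ λ x → (pow x (suc n) + evalCoeffs cs x) ≈ 0#

  module Weierstrass (a₁ a₂ a₃ a₄ a₆ : Carrier) where
    two three four eight nine twentyseven : Carrier
    two = fromℕ 2
    three = fromℕ 3
    four = fromℕ 4
    eight = fromℕ 8
    nine = fromℕ 9
    twentyseven = fromℕ 27

    b₂ b₄ b₆ b₈ Δ : Carrier
    b₂ = a₁ * a₁ + four * a₂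
    b₄ = two * a₄ + a₁ * a₃
    b₆ = a₃ * a₃ + four * a₆
    b₈ = a₁ * a₁ * a₆ + four * a₂ * a₆ - a₁ * a₃ * a₄ + a₂ * a₃ * a₃ - a₄ * a₄
    Δ = - (b₂ * b₂ * b₈) - eight * b₄ * b₄ * b₄ - twentyseven * b₆ * b₆
        + nine * b₂ * b₄ * b₆

  -- binary quadratic form  c₀ x₁² + c₁ x₁x₂ + c₂ x₂²,  given by its coefficients
  Form2 : Set c
  Form2 = Fin 3 → Carrier

  -- binary quartic form  Σₖ cₖ x₁^(4-k) x₂^k,  given by its coefficients
  Form4 : Set c
  Form4 = Fin 5 → Carrier

  _≈₂_ : Form2 → Form2 → Set ℓ
  f ≈₂ g = ∀ i → f i ≈ g i

  _≈₄_ : Form4 → Form4 → Set ℓ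
  f ≈₄ g = ∀ i → f i ≈ g i

  sq : Form2 → Form4
  sq f zero = f zero * f zero
  sq f (suc zero) = (1# + 1#) * (f zero * f (suc zero))
  sq f (suc (suc zero)) = f (suc zero) * f (suc zero) + (1# + 1#) * (f zero * f (suc (suc zero)))
  sq f (suc (suc (suc zero))) = (1# + 1#) * (f (suc zero) * f (suc (suc zero)))
  sq f (suc (suc (suc (suc zero)))) = f (suc (suc zero)) * f (suc (suc zero))

  xsq : Fin 2 → Form2
  xsq zero zero = 1#
  xsq zero (suc _) = 0#
  xsq (suc zero) (suc (suc zero)) = 1#
  xsq (suc zero) _ = 0#

  lin2 : (Fin 3 → Carrier) → (Fin 3 → Form2) → Form2
  lin2 l f i = l zero * f zero i + (l (suc zero) * f (suc zero) i + l (suc (suc zero)) * f (suc (suc zero)) i)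

  lin4 : (Fin 2 → Carrier) → (Fin 2 → Form4) → Form4
  lin4 l f i = l zero * f zero i + l (suc zero) * f (suc zero) i

  δ : (a₁ a₂ a₃ a₄ a₆ : Carrier) → Fin 2 → Form4
  δ a₁ a₂ a₃ a₄ a₆ zero zero = 1#
  δ a₁ a₂ a₃ a₄ a₆ zero (suc zero) = 0#
  δ a₁ a₂ a₃ a₄ a₆ zero (suc (suc zero)) = - Weierstrass.b₄ a₁ a₂ a₃ a₄ a₆
  δ a₁ a₂ a₃ a₄ a₆ zero (suc (suc (suc zero))) = - (Weierstrass.two a₁ a₂ a₃ a₄ a₆ * Weierstrass.b₆ a₁ a₂ a₃ a₄ a₆)
  δ a₁ a₂ a₃ a₄ a₆ zero (suc (suc (suc (suc zero)))) = - Weierstrass.b₈ a₁ a₂ a₃ a₄ a₆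
  δ a₁ a₂ a₃ a₄ a₆ (suc zero) zero = 0#
  δ a₁ a₂ a₃ a₄ a₆ (suc zero) (suc zero) = Weierstrass.four a₁ a₂ a₃ a₄ a₆
  δ a₁ a₂ a₃ a₄ a₆ (suc zero) (suc (suc zero)) = Weierstrass.b₂ a₁ a₂ a₃ a₄ a₆
  δ a₁ a₂ a₃ a₄ a₆ (suc zero) (suc (suc (suc zero))) = Weierstrass.two a₁ a₂ a₃ a₄ a₆ * Weierstrass.b₄ a₁ a₂ a₃ a₄ a₆
  δ a₁ a₂ a₃ a₄ a₆ (suc zero) (suc (suc (suc (suc zero)))) = Weierstrass.b₆ a₁ a₂ a₃ a₄ a₆

module Submission where

-- Put h(u) = u³ + b₂u² + 8b₄u + 16b₆, which is 16 times the 2-division polynomial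
-- 4x³ + b₂x² + 2b₄x + b₆ at x = u/4, and y_u = 8x₁² − 4u x₁x₂ − (u² + b₂u + 4b₄)x₂².
-- Comparing coefficients, y_u² = 64δ₁ − 16uδ₂ holds exactly when h(u) = 0 (using the
-- relation 4b₈ = b₂b₆ − b₄²). The discriminant of h is 256Δ ≠ 0, so over the algebraically
-- closed K it has three distinct roots u₁, u₂, u₃. As y_u depends quadratically on u, the
-- Vandermonde determinant makes y_{u₁}, y_{u₂}, y_{u₃} a basis of the binary quadratic forms,
-- so x₁² and x₂² are linear combinations of them.

open import Defs
open import Level using (_⊔_)
open import Data.Fin using (Fin; zero; suc)
open import Data.Product using (Σ; _×_; _,_; proj₁; proj₂)
open import Data.Nat as ℕ using (ℕ; zero; suc)
import Data.Nat.Properties as ℕ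
open import Data.Integer as ℤ using (ℤ; +_; -[1+_]; _⊖_; sign; ∣_∣; _◃_)
import Data.Integer.Properties as ℤ
open import Data.Sign as Sign using (Sign)
open import Data.Sum using (inj₁; inj₂)
open import Data.Maybe using (Maybe; just; nothing)
open import Data.Vec using (Vec; []; _∷_; lookup)
open import Data.Vec.N-ary using (N-ary)
import Relation.Binary.PropositionalEquality as ≡
open import Relation.Nullary using (¬_; yes; no)
open import Algebra.Bundles using (CommutativeRing)
open import Algebra.Solver.Ring.AlmostCommutativeRing
  using (fromCommutativeRing; _-Raw-AlmostCommutative⟶_)

module IntegerCoefficientSolver {c ℓ} (K : CommutativeRing c ℓ) where
  open CommutativeRing K
  open import Algebra.Properties.Semiring.Mult semiring using (×-homo-+; ×1-homo-*) renaming (_×_ to _×ᴺ_)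
  open import Algebra.Properties.Ring ring using (-‿involutive; -0#≈0#; -1*x≈-x)
  open import Algebra.Properties.AbelianGroup +-abelianGroup using (⁻¹-∙-comm)
  open import Algebra.Properties.CommutativeSemigroup *-commutativeSemigroup using (interchange)
  open import Relation.Binary.Reasoning.Setoid setoid

  ι : ℕ → Carrier
  ι n = n ×ᴺ 1#

  ι≈fromℕ : ∀ n → ι n ≈ fromℕ K n
  ι≈fromℕ zero = refl
  ι≈fromℕ (suc n) = +-congˡ (ι≈fromℕ n)

  fromℤ : ℤ → Carrier
  fromℤ (+ n) = ι n
  fromℤ -[1+ n ] = - ι (suc n)

  fromℤ-homo-neg : ∀ i → fromℤ (ℤ.- i) ≈ - fromℤ i
  fromℤ-homo-neg (+ zero) = sym -0#≈0#
  fromℤ-homo-neg (+ suc n) = refl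
  fromℤ-homo-neg -[1+ n ] = sym (-‿involutive _)

  ι-homo-∸ : ∀ m n → n ℕ.≤ m → ι (m ℕ.∸ n) ≈ ι m - ι n
  ι-homo-∸ m n n≤m = begin
    ι (m ℕ.∸ n)               ≈⟨ sym (+-identityʳ _) ⟩
    ι (m ℕ.∸ n) + 0#          ≈⟨ +-congˡ (sym (-‿inverseʳ _)) ⟩
    ι (m ℕ.∸ n) + (ι n - ι n) ≈⟨ sym (+-assoc _ _ _) ⟩
    (ι (m ℕ.∸ n) + ι n) - ι n ≈⟨ +-congʳ (sym (×-homo-+ 1# (m ℕ.∸ n) n)) ⟩
    ι (m ℕ.∸ n ℕ.+ n) - ι n   ≡⟨ ≡.cong (λ k → ι k - ι n) (ℕ.m∸n+n≡m n≤m) ⟩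
    ι m - ι n                 ∎

  fromℤ-homo-⊖ : ∀ m n → fromℤ (m ⊖ n) ≈ ι m - ι n
  fromℤ-homo-⊖ m n with ℕ.≤-total n m
  ... | inj₁ n≤m = begin
    fromℤ (m ⊖ n) ≡⟨ ≡.cong fromℤ (ℤ.⊖-≥ n≤m) ⟩
    ι (m ℕ.∸ n)   ≈⟨ ι-homo-∸ m n n≤m ⟩
    ι m - ι n     ∎
  ... | inj₂ m≤n = begin
    fromℤ (m ⊖ n)             ≡⟨ ≡.cong fromℤ (ℤ.⊖-≤ m≤n) ⟩
    fromℤ (ℤ.- (+ (n ℕ.∸ m))) ≈⟨ fromℤ-homo-neg (+ (n ℕ.∸ m)) ⟩
    - ι (n ℕ.∸ m)             ≈⟨ -‿cong (ι-homo-∸ n m m≤n) ⟩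
    - (ι n - ι m)             ≈⟨ ⁻¹-∙-comm _ _ ⟨
    - ι n + - (- ι m)         ≈⟨ +-congˡ (-‿involutive _) ⟩
    - ι n + ι m               ≈⟨ +-comm _ _ ⟩
    ι m - ι n                 ∎

  fromℤ-homo-+ : ∀ i j → fromℤ (i ℤ.+ j) ≈ fromℤ i + fromℤ j
  fromℤ-homo-+ -[1+ m ] -[1+ n ] = begin
    - ι (suc (suc (m ℕ.+ n))) ≡⟨ ≡.cong (λ k → - ι (suc k)) (ℕ.+-suc m n) ⟨
    - ι (suc m ℕ.+ suc n)     ≈⟨ -‿cong (×-homo-+ 1# (suc m) (suc n)) ⟩
    - (ι (suc m) + ι (suc n)) ≈⟨ ⁻¹-∙-comm _ _ ⟨
    - ι (suc m) + - ι (suc n) ∎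
  fromℤ-homo-+ -[1+ m ] (+ n) = trans (fromℤ-homo-⊖ n (suc m)) (+-comm _ _)
  fromℤ-homo-+ (+ m) -[1+ n ] = fromℤ-homo-⊖ m (suc n)
  fromℤ-homo-+ (+ m) (+ n) = ×-homo-+ 1# m n

  fromSign : Sign → Carrier
  fromSign Sign.+ = 1#
  fromSign Sign.- = - 1#

  fromSign-homo-* : ∀ s t → fromSign (s Sign.* t) ≈ fromSign s * fromSign t
  fromSign-homo-* Sign.+ t = sym (*-identityˡ _)
  fromSign-homo-* Sign.- Sign.+ = sym (*-identityʳ _)
  fromSign-homo-* Sign.- Sign.- = sym (trans (-1*x≈-x _) (-‿involutive _))

  fromℤ-◃ : ∀ s n → fromℤ (s ◃ n) ≈ fromSign s * ι n
  fromℤ-◃ s zero = sym (zeroʳ _)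
  fromℤ-◃ Sign.+ (suc n) = sym (*-identityˡ _)
  fromℤ-◃ Sign.- (suc n) = sym (-1*x≈-x _)

  fromℤ-sign◃∣∣ : ∀ i → fromℤ i ≈ fromSign (sign i) * ι ∣ i ∣
  fromℤ-sign◃∣∣ i = begin
    fromℤ i                     ≡⟨ ≡.cong fromℤ (ℤ.signᵢ◃∣i∣≡i i) ⟨
    fromℤ (sign i ◃ ∣ i ∣)      ≈⟨ fromℤ-◃ (sign i) ∣ i ∣ ⟩
    fromSign (sign i) * ι ∣ i ∣ ∎

  fromℤ-homo-* : ∀ i j → fromℤ (i ℤ.* j) ≈ fromℤ i * fromℤ j
  fromℤ-homo-* i j = begin
    fromℤ (i ℤ.* j)                                       ≈⟨ fromℤ-◃ (sign i Sign.* sign j) (∣ i ∣ ℕ.* ∣ j ∣) ⟩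
    fromSign (sign i Sign.* sign j) * ι (∣ i ∣ ℕ.* ∣ j ∣) ≈⟨ *-cong (fromSign-homo-* (sign i) (sign j)) (×1-homo-* ∣ i ∣ ∣ j ∣) ⟩
    (s * t) * (m * n)                                     ≈⟨ interchange s t m n ⟩
    (s * m) * (t * n)                                     ≈⟨ *-cong (fromℤ-sign◃∣∣ i) (fromℤ-sign◃∣∣ j) ⟨
    fromℤ i * fromℤ j                                     ∎
    where
    s t m n : Carrier
    s = fromSign (sign i)
    t = fromSign (sign j)
    m = ι ∣ i ∣
    n = ι ∣ j ∣

  fromℤ-hom : ℤ.+-*-rawRing -Raw-AlmostCommutative⟶ fromCommutativeRing K
  fromℤ-hom = record
    { ⟦_⟧ = fromℤ ; +-homo = fromℤ-homo-+ ; *-homo = fromℤ-homo-* ; -‿homo = fromℤ-homo-neg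
    ; 0-homo = refl ; 1-homo = +-identityʳ 1# }

  fromℤ-≟ : ∀ i j → Maybe (fromℤ i ≈ fromℤ j)
  fromℤ-≟ i j with i ℤ.≟ j
  ... | yes ≡.refl = just refl
  ... | no _ = nothing

  open import Algebra.Solver.Ring ℤ.+-*-rawRing (fromCommutativeRing K) fromℤ-hom fromℤ-≟ public

  -- Evaluates to 1# itself, whereas con (+ 1) evaluates to 1# + 0#.
  :1# : ∀ {n} → Polynomial n
  :1# = con (+ 0) :^ 0

module _ {c ℓ} (K : CommutativeRing c ℓ) where
  open CommutativeRing K hiding (zero)
  open IntegerCoefficientSolver K
  open import Relation.Binary.Reasoning.Setoid setoid

  ≈-modulo : ∀ {x y a s t} → s ≈ t → x ≈ y + a * (s - t) → x ≈ y
  ≈-modulo {x} {y} {a} {s} {t} s≈t x≈y+a[s-t] = begin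
    x               ≈⟨ x≈y+a[s-t] ⟩
    y + a * (s - t) ≈⟨ +-congˡ (*-congˡ (trans (+-congʳ s≈t) (-‿inverseʳ t))) ⟩
    y + a * 0#      ≈⟨ +-congˡ (zeroʳ a) ⟩
    y + 0#          ≈⟨ +-identityʳ y ⟩
    y               ∎

  cubic : (p q r x : Carrier) → Carrier
  cubic p q r x = x * x * x + p * x * x + q * x + r

  cubic-cong : ∀ {p p′ q q′ r r′} → p ≈ p′ → q ≈ q′ → r ≈ r′ → ∀ x → cubic p q r x ≈ cubic p′ q′ r′ x
  cubic-cong p≈p′ q≈q′ r≈r′ x = +-cong (+-cong (+-congˡ (*-congʳ (*-congʳ p≈p′))) (*-congʳ q≈q′)) r≈r′

  discriminant : (p q r : Carrier) → Carrier
  discriminant p q r =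
    p * p * (q * q) - ι 4 * (q * q * q) - ι 4 * (p * p * p * r) - ι 27 * (r * r) + ι 18 * (p * q * r)

  discriminant-cong : ∀ {p p′ q q′ r r′} → p ≈ p′ → q ≈ q′ → r ≈ r′ →
                      discriminant p q r ≈ discriminant p′ q′ r′
  discriminant-cong p≈p′ q≈q′ r≈r′ = +-cong (+-cong (+-cong (+-cong
    (*-cong (*-cong p≈p′ p≈p′) (*-cong q≈q′ q≈q′))
    (-‿cong (*-congˡ (*-cong (*-cong q≈q′ q≈q′) q≈q′))))
    (-‿cong (*-congˡ (*-cong (*-cong (*-cong p≈p′ p≈p′) p≈p′) r≈r′))))
    (-‿cong (*-congˡ (*-cong r≈r′ r≈r′))))
    (*-congˡ (*-cong (*-cong p≈p′ q≈q′) r≈r′))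

  differenceProduct : (u₁ u₂ u₃ : Carrier) → Carrier
  differenceProduct u₁ u₂ u₃ = (u₁ - u₂) * (u₁ - u₃) * (u₂ - u₃)

  record CubicSplitting (p q r : Carrier) : Set (c ⊔ ℓ) where
    field
      u₁ u₂ u₃ : Carrier
      p≈-e₁ : p ≈ - (u₁ + u₂ + u₃)
      q≈e₂ : q ≈ u₁ * u₂ + u₁ * u₃ + u₂ * u₃
      r≈-e₃ : r ≈ - (u₁ * u₂ * u₃)

    roots : Vec Carrier 3
    roots = u₁ ∷ u₂ ∷ u₃ ∷ []

    cubic≈∏x-uᵢ : ∀ x → cubic p q r x ≈ (x - u₁) * (x - u₂) * (x - u₃)
    cubic≈∏x-uᵢ x = trans (cubic-cong p≈-e₁ q≈e₂ r≈-e₃ x) (solve 4 (λ X U₁ U₂ U₃ →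
      X :* X :* X :+ :- (U₁ :+ U₂ :+ U₃) :* X :* X :+ (U₁ :* U₂ :+ U₁ :* U₃ :+ U₂ :* U₃) :* X :+ :- (U₁ :* U₂ :* U₃)
      := (X :- U₁) :* (X :- U₂) :* (X :- U₃)) refl x u₁ u₂ u₃)

    isRoot : ∀ j → cubic p q r (lookup roots j) ≈ 0#
    isRoot zero = trans (cubic≈∏x-uᵢ u₁) (solve 3 (λ U₁ U₂ U₃ →
      (U₁ :- U₁) :* (U₁ :- U₂) :* (U₁ :- U₃) := con (+ 0)) refl u₁ u₂ u₃)
    isRoot (suc zero) = trans (cubic≈∏x-uᵢ u₂) (solve 3 (λ U₁ U₂ U₃ →
      (U₂ :- U₁) :* (U₂ :- U₂) :* (U₂ :- U₃) := con (+ 0)) refl u₁ u₂ u₃)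
    isRoot (suc (suc zero)) = trans (cubic≈∏x-uᵢ u₃) (solve 3 (λ U₁ U₂ U₃ →
      (U₃ :- U₁) :* (U₃ :- U₂) :* (U₃ :- U₃) := con (+ 0)) refl u₁ u₂ u₃)

    discriminant≈Π² : discriminant p q r ≈ differenceProduct u₁ u₂ u₃ * differenceProduct u₁ u₂ u₃
    discriminant≈Π² = trans (discriminant-cong p≈-e₁ q≈e₂ r≈-e₃) (solve 3 (λ U₁ U₂ U₃ →
      let P = :- (U₁ :+ U₂ :+ U₃)
          Q = U₁ :* U₂ :+ U₁ :* U₃ :+ U₂ :* U₃
          R = :- (U₁ :* U₂ :* U₃)
          Π = (U₁ :- U₂) :* (U₁ :- U₃) :* (U₂ :- U₃)
      in P :* P :* (Q :* Q) :- con (+ 4) :* (Q :* Q :* Q) :- con (+ 4) :* (P :* P :* P :* R)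
         :- con (+ 27) :* (R :* R) :+ con (+ 18) :* (P :* Q :* R)
      := Π :* Π) refl u₁ u₂ u₃)

  module _ (algClosed : AlgClosed K) where

    cubic-root : ∀ p q r → Σ Carrier λ x → cubic p q r x ≈ 0#
    cubic-root p q r with algClosed 2 (r ∷ q ∷ p ∷ [])
    ... | x , root = x , trans (solve 4 (λ X P Q R →
      X :* X :* X :+ P :* X :* X :+ Q :* X :+ R
      := X :* (X :* (X :* :1#)) :+ (R :+ X :* (Q :+ X :* (P :+ X :* con (+ 0))))) refl x p q r) root

    quadratic-root : ∀ p q → Σ Carrier λ x → x * x + p * x + q ≈ 0#
    quadratic-root p q with algClosed 1 (q ∷ p ∷ [])
    ... | x , root = x , trans (solve 3 (λ X P Q →
      X :* X :+ P :* X :+ Q := X :* (X :* :1#) :+ (Q :+ X :* (P :+ X :* con (+ 0)))) refl x p q) root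

    -- u₂ is a root of the quotient (x³ + p x² + q x + r) / (x - u₁).
    splitCubic : ∀ p q r → CubicSplitting p q r
    splitCubic p q r = record
      { u₁ = u₁ ; u₂ = u₂ ; u₃ = u₃
      ; p≈-e₁ = solve 3 (λ P U₁ U₂ → P := :- (U₁ :+ U₂ :+ :- (P :+ U₁ :+ U₂))) refl p u₁ u₂
      ; q≈e₂ = ≈-modulo quotient-root (solve 4 (λ P Q U₁ U₂ →
          let U₃ = :- (P :+ U₁ :+ U₂)
          in Q := U₁ :* U₂ :+ U₁ :* U₃ :+ U₂ :* U₃
                  :+ :1# :* (U₂ :* U₂ :+ (P :+ U₁) :* U₂ :+ (U₁ :* U₁ :+ P :* U₁ :+ Q) :- con (+ 0)))
          refl p q u₁ u₂)
      ; r≈-e₃ = ≈-modulo cubic-root-u₁ (≈-modulo quotient-root (solve 5 (λ P Q R U₁ U₂ →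
          let U₃ = :- (P :+ U₁ :+ U₂)
          in R := :- (U₁ :* U₂ :* U₃)
                  :+ :1# :* (U₁ :* U₁ :* U₁ :+ P :* U₁ :* U₁ :+ Q :* U₁ :+ R :- con (+ 0))
                  :+ (:- U₁) :* (U₂ :* U₂ :+ (P :+ U₁) :* U₂ :+ (U₁ :* U₁ :+ P :* U₁ :+ Q) :- con (+ 0)))
          refl p q r u₁ u₂))
      }
      where
      u₁ u₂ u₃ : Carrier
      u₁ = proj₁ (cubic-root p q r)
      u₂ = proj₁ (quadratic-root (p + u₁) (u₁ * u₁ + p * u₁ + q))
      u₃ = - (p + u₁ + u₂)
      cubic-root-u₁ : cubic p q r u₁ ≈ 0#
      cubic-root-u₁ = proj₂ (cubic-root p q r)
      quotient-root : u₂ * u₂ + (p + u₁) * u₂ + (u₁ * u₁ + p * u₁ + q) ≈ 0#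
      quotient-root = proj₂ (quadratic-root (p + u₁) (u₁ * u₁ + p * u₁ + q))

  x*y≈0⇒y≈0 : IsField K → ∀ {x y} → ¬ x ≈ 0# → x * y ≈ 0# → y ≈ 0#
  x*y≈0⇒y≈0 isField {x} {y} x≉0 xy≈0 with proj₂ isField x x≉0
  ... | x⁻¹ , xx⁻¹≈1 = begin
    y             ≈⟨ *-identityˡ y ⟨
    1# * y        ≈⟨ *-congʳ (trans (sym xx⁻¹≈1) (*-comm x x⁻¹)) ⟩
    (x⁻¹ * x) * y ≈⟨ *-assoc x⁻¹ x y ⟩
    x⁻¹ * (x * y) ≈⟨ *-congˡ xy≈0 ⟩
    x⁻¹ * 0#      ≈⟨ zeroʳ x⁻¹ ⟩
    0#            ∎

  ι-suc≉0 : CharZero K → ∀ n → ¬ ι (suc n) ≈ 0#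
  ι-suc≉0 charZero n ι[1+n]≈0 with charZero (suc n) (trans (sym (ι≈fromℕ (suc n))) ι[1+n]≈0)
  ... | ()

  module Pencil (b₂ b₄ : Carrier) where

    yForm : Carrier → Form2 K
    yForm u zero = ι 8
    yForm u (suc zero) = - (ι 4 * u)
    yForm u (suc (suc zero)) = - (u * u + b₂ * u + ι 4 * b₄)

    weight : Carrier → Fin 2 → Carrier → Carrier → Carrier
    weight w zero s t = (s * t - ι 4 * b₄) * (s - t) * w
    weight w (suc zero) s t = - (ι 8 * (s - t)) * w

    -- With w = (8Π)⁻¹, row i inverts the matrix expressing the yForm uⱼ in x₁², x₁x₂, x₂².
    weights : (u₁ u₂ u₃ w : Carrier) → Fin 2 → Fin 3 → Carrier
    weights u₁ u₂ u₃ w i zero = weight w i u₂ u₃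
    weights u₁ u₂ u₃ w i (suc zero) = weight w i u₃ u₁
    weights u₁ u₂ u₃ w i (suc (suc zero)) = weight w i u₁ u₂

    private
      yFormᴾ : ∀ {n} → (B₂ B₄ U : Polynomial n) → Fin 3 → Polynomial n
      yFormᴾ B₂ B₄ U zero = con (+ 8)
      yFormᴾ B₂ B₄ U (suc zero) = :- (con (+ 4) :* U)
      yFormᴾ B₂ B₄ U (suc (suc zero)) = :- (U :* U :+ B₂ :* U :+ con (+ 4) :* B₄)

      weightᴾ : ∀ {n} → (B₄ W : Polynomial n) → Fin 2 → Polynomial n → Polynomial n → Polynomial n
      weightᴾ B₄ W zero S T = (S :* T :- con (+ 4) :* B₄) :* (S :- T) :* W
      weightᴾ B₄ W (suc zero) S T = :- (con (+ 8) :* (S :- T)) :* W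

      xsqᴾ : ∀ {n} → Fin 2 → Fin 3 → Polynomial n
      xsqᴾ zero zero = :1#
      xsqᴾ (suc zero) (suc (suc zero)) = :1#
      xsqᴾ _ _ = con (+ 0)

      spanEquation : Fin 2 → Fin 3 → N-ary 6 (Polynomial 6) (Polynomial 6 × Polynomial 6)
      spanEquation i k B₂ B₄ W U₁ U₂ U₃ =
        con (+ 8) :* ((U₁ :- U₂) :* (U₁ :- U₃) :* (U₂ :- U₃)) :* W :* xsqᴾ i k
        := weightᴾ B₄ W i U₂ U₃ :* yFormᴾ B₂ B₄ U₁ k
           :+ (weightᴾ B₄ W i U₃ U₁ :* yFormᴾ B₂ B₄ U₂ k :+ weightᴾ B₄ W i U₁ U₂ :* yFormᴾ B₂ B₄ U₃ k)

    span-identity : ∀ u₁ u₂ u₃ w i k →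
      ι 8 * differenceProduct u₁ u₂ u₃ * w * xsq K i k
        ≈ lin2 K (weights u₁ u₂ u₃ w i) (λ j → yForm (lookup (u₁ ∷ u₂ ∷ u₃ ∷ []) j)) k
    span-identity u₁ u₂ u₃ w zero zero = solve 6 (spanEquation zero zero) refl b₂ b₄ w u₁ u₂ u₃
    span-identity u₁ u₂ u₃ w zero (suc zero) = solve 6 (spanEquation zero (suc zero)) refl b₂ b₄ w u₁ u₂ u₃
    span-identity u₁ u₂ u₃ w zero (suc (suc zero)) = solve 6 (spanEquation zero (suc (suc zero))) refl b₂ b₄ w u₁ u₂ u₃
    span-identity u₁ u₂ u₃ w (suc zero) zero = solve 6 (spanEquation (suc zero) zero) refl b₂ b₄ w u₁ u₂ u₃
    span-identity u₁ u₂ u₃ w (suc zero) (suc zero) = solve 6 (spanEquation (suc zero) (suc zero)) refl b₂ b₄ w u₁ u₂ u₃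
    span-identity u₁ u₂ u₃ w (suc zero) (suc (suc zero)) = solve 6 (spanEquation (suc zero) (suc (suc zero))) refl b₂ b₄ w u₁ u₂ u₃

    xsq-in-span : ∀ {u₁ u₂ u₃ w} → ι 8 * differenceProduct u₁ u₂ u₃ * w ≈ 1# →
      ∀ i → _≈₂_ K (xsq K i) (lin2 K (weights u₁ u₂ u₃ w i) (λ j → yForm (lookup (u₁ ∷ u₂ ∷ u₃ ∷ []) j)))
    xsq-in-span {u₁} {u₂} {u₃} {w} 8Πw≈1 i k = begin
      xsq K i k                                                                    ≈⟨ *-identityˡ _ ⟨
      1# * xsq K i k                                                               ≈⟨ *-congʳ 8Πw≈1 ⟨
      ι 8 * differenceProduct u₁ u₂ u₃ * w * xsq K i k                             ≈⟨ span-identity u₁ u₂ u₃ w i k ⟩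
      lin2 K (weights u₁ u₂ u₃ w i) (λ j → yForm (lookup (u₁ ∷ u₂ ∷ u₃ ∷ []) j)) k ∎

  module Curve (a₁ a₂ a₃ a₄ a₆ : Carrier) where
    open Weierstrass K a₁ a₂ a₃ a₄ a₆
    open Pencil b₂ b₄ public

    4b₈≈b₂b₆-b₄² : ι 4 * b₈ ≈ b₂ * b₆ - b₄ * b₄
    4b₈≈b₂b₆-b₄² = solve 5 (λ A₁ A₂ A₃ A₄ A₆ →
      let B₂ = A₁ :* A₁ :+ con (+ 4) :* A₂
          B₄ = con (+ 2) :* A₄ :+ A₁ :* A₃
          B₆ = A₃ :* A₃ :+ con (+ 4) :* A₆
          B₈ = A₁ :* A₁ :* A₆ :+ con (+ 4) :* A₂ :* A₆ :- A₁ :* A₃ :* A₄ :+ A₂ :* A₃ :* A₃ :- A₄ :* A₄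
      in con (+ 4) :* B₈ := B₂ :* B₆ :- B₄ :* B₄) refl a₁ a₂ a₃ a₄ a₆

    discriminant≈256Δ : discriminant b₂ (ι 8 * b₄) (ι 16 * b₆) ≈ ι 256 * Δ
    discriminant≈256Δ = ≈-modulo 4b₈≈b₂b₆-b₄² (solve 4 (λ B₂ B₄ B₆ B₈ →
      let Q = con (+ 8) :* B₄
          R = con (+ 16) :* B₆
      in B₂ :* B₂ :* (Q :* Q) :- con (+ 4) :* (Q :* Q :* Q) :- con (+ 4) :* (B₂ :* B₂ :* B₂ :* R)
         :- con (+ 27) :* (R :* R) :+ con (+ 18) :* (B₂ :* Q :* R)
      := con (+ 256) :* (:- (B₂ :* B₂ :* B₈) :- con (+ 8) :* B₄ :* B₄ :* B₄ :- con (+ 27) :* B₆ :* B₆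
                         :+ con (+ 9) :* B₂ :* B₄ :* B₆)
         :+ con (+ 64) :* (B₂ :* B₂) :* (con (+ 4) :* B₈ :- (B₂ :* B₆ :- B₄ :* B₄))) refl b₂ b₄ b₆ b₈)

    squareWeights : Carrier → Fin 2 → Carrier
    squareWeights u zero = ι 64
    squareWeights u (suc zero) = - (ι 16 * u)

    sq-yForm : ∀ {u} → cubic b₂ (ι 8 * b₄) (ι 16 * b₆) u ≈ 0# →
               _≈₄_ K (sq K (yForm u)) (lin4 K (squareWeights u) (δ K a₁ a₂ a₃ a₄ a₆))
    sq-yForm {u} h≈0 zero = solve 1 (λ U →
      con (+ 8) :* con (+ 8) := con (+ 64) :* :1# :+ :- (con (+ 16) :* U) :* con (+ 0)) refl u
    sq-yForm {u} h≈0 (suc zero) = solve 1 (λ U →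
      (:1# :+ :1#) :* (con (+ 8) :* :- (con (+ 4) :* U))
      := con (+ 64) :* con (+ 0) :+ :- (con (+ 16) :* U) :* con (+ 4)) refl u
    sq-yForm {u} h≈0 (suc (suc zero)) = solve 3 (λ U B₂ B₄ →
      :- (con (+ 4) :* U) :* :- (con (+ 4) :* U)
        :+ (:1# :+ :1#) :* (con (+ 8) :* :- (U :* U :+ B₂ :* U :+ con (+ 4) :* B₄))
      := con (+ 64) :* :- B₄ :+ :- (con (+ 16) :* U) :* B₂) refl u b₂ b₄
    sq-yForm {u} h≈0 (suc (suc (suc zero))) = ≈-modulo h≈0 (solve 4 (λ U B₂ B₄ B₆ →
      (:1# :+ :1#) :* (:- (con (+ 4) :* U) :* :- (U :* U :+ B₂ :* U :+ con (+ 4) :* B₄))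
      := con (+ 64) :* :- (con (+ 2) :* B₆) :+ :- (con (+ 16) :* U) :* (con (+ 2) :* B₄)
         :+ con (+ 8) :* (U :* U :* U :+ B₂ :* U :* U :+ con (+ 8) :* B₄ :* U :+ con (+ 16) :* B₆ :- con (+ 0)))
      refl u b₂ b₄ b₆)
    sq-yForm {u} h≈0 (suc (suc (suc (suc zero)))) = ≈-modulo h≈0 (≈-modulo 4b₈≈b₂b₆-b₄² (solve 5 (λ U B₂ B₄ B₆ B₈ →
      :- (U :* U :+ B₂ :* U :+ con (+ 4) :* B₄) :* :- (U :* U :+ B₂ :* U :+ con (+ 4) :* B₄)
      := con (+ 64) :* :- B₈ :+ :- (con (+ 16) :* U) :* B₆
         :+ (U :+ B₂) :* (U :* U :* U :+ B₂ :* U :* U :+ con (+ 8) :* B₄ :* U :+ con (+ 16) :* B₆ :- con (+ 0))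
         :+ con (+ 16) :* (con (+ 4) :* B₈ :- (B₂ :* B₆ :- B₄ :* B₄)))
      refl u b₂ b₄ b₆ b₈))

    Δ≉0⇒8Π≉0 : IsField K → CharZero K → ¬ Δ ≈ 0# → (split : CubicSplitting b₂ (ι 8 * b₄) (ι 16 * b₆)) →
           let open CubicSplitting split in ¬ ι 8 * differenceProduct u₁ u₂ u₃ ≈ 0#
    Δ≉0⇒8Π≉0 isField charZero Δ≉0 split 8Π≈0 = Δ≉0 (x*y≈0⇒y≈0 isField (ι-suc≉0 charZero 255) (begin
      ι 256 * Δ                              ≈⟨ discriminant≈256Δ ⟨
      discriminant b₂ (ι 8 * b₄) (ι 16 * b₆) ≈⟨ discriminant≈Π² ⟩
      Π * Π                                  ≈⟨ *-congʳ Π≈0 ⟩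
      0# * Π                                 ≈⟨ zeroˡ Π ⟩
      0#                                     ∎))
      where
      open CubicSplitting split
      Π : Carrier
      Π = differenceProduct u₁ u₂ u₃
      Π≈0 : Π ≈ 0#
      Π≈0 = x*y≈0⇒y≈0 isField (ι-suc≉0 charZero 7) 8Π≈0

proposition2p1 : ∀ {c ℓ} (K : CommutativeRing c ℓ) → IsField K → CharZero K → AlgClosed K →
    (a₁ a₂ a₃ a₄ a₆ : CommutativeRing.Carrier K) →
    ¬ (CommutativeRing._≈_ K (Weierstrass.Δ K a₁ a₂ a₃ a₄ a₆) (CommutativeRing.0# K)) →
    Σ (Fin 3 → Form2 K) λ y →
    Σ (Fin 2 → Fin 3 → CommutativeRing.Carrier K) λ a →
    Σ (Fin 3 → Fin 2 → CommutativeRing.Carrier K) λ b →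
      (∀ i → _≈₂_ K (xsq K i) (lin2 K (a i) y)) ×
      (∀ j → _≈₄_ K (sq K (y j)) (lin4 K (b j) (δ K a₁ a₂ a₃ a₄ a₆)))
proposition2p1 K isField charZero algClosed a₁ a₂ a₃ a₄ a₆ Δ≉0 =
  (λ j → yForm (lookup roots j)) , weights u₁ u₂ u₃ w , (λ j → squareWeights (lookup roots j)) ,
  xsq-in-span 8Πw≈1 , λ j → sq-yForm (isRoot j)
  where
  open CommutativeRing K using (Carrier; _*_; _≈_; 1#)
  open IntegerCoefficientSolver K using (ι)
  open Weierstrass K a₁ a₂ a₃ a₄ a₆ using (b₂; b₄; b₆)
  open Curve K a₁ a₂ a₃ a₄ a₆
  split : CubicSplitting K b₂ (ι 8 * b₄) (ι 16 * b₆)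
  split = splitCubic K algClosed b₂ (ι 8 * b₄) (ι 16 * b₆)
  open CubicSplitting split
  inverse : Σ Carrier λ w → ι 8 * differenceProduct K u₁ u₂ u₃ * w ≈ 1#
  inverse = proj₂ isField _ (Δ≉0⇒8Π≉0 isField charZero Δ≉0 split)
  w : Carrier
  w = proj₁ inverse
  8Πw≈1 : ι 8 * differenceProduct K u₁ u₂ u₃ * w ≈ 1#
  8Πw≈1 = proj₂ inverse
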